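{- Let $q\geq 3$ be an odd integer, $r$ the order of $2$ modulo $q$, and let $q_2=1$ if $2$ is a square modulo $q$ and $q_2=0$ otherwise. Then the number $|\mathcal{E}'(q)|$ of semi-bad classes modulo $q$ is $$|\mathcal{E}'(q)|=2^{\omega(q)}\left(\left\lfloor\frac{r+1}{2}\right\rfloor+q_2\left\lfloor\frac r2\right\rfloor\right)-r=\begin{cases} r(2^{\omega(q)-1}-1) & \text{if $r$ is even and } q_2=0,\\ r(2^{\omega(q)}-1) & \text{otherwise,}\end{cases}$$ where $\omega(q)$ is the number of distinct prime factors of $q$.
   Context: The order $r$ of $2$ modulo $q$ is the least positive integer with $2^r\equiv 1\pmod q$. The bad classes modulo $q$ are the elements of $\mathcal{E}(q)=\{1,2,\dots,2^{r-1}\}\subset(\mathbb{Z}/q\mathbb{Z})^*$. A class of $(\mathbb{Z}/q\mathbb{Z})^*$ is semi-bad if it does not belong to $\mathcal{E}(q)$ but its square does; $\mathcal{E}'(q)$ is the set of semi-bad classes. -}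

module Defs where

open import Data.Nat using (ℕ; suc; _+_; _*_; _^_; _<_; _≤_)
open import Data.Nat.Divisibility using (_∣_)
open import Data.Nat.Coprimality using (Coprime)
open import Data.Nat.Primality using (Prime)
open import Data.List using (List; length)
open import Data.List.Membership.Propositional using (_∈_)
open import Data.List.Relation.Unary.Unique.Propositional using (Unique)
open import Data.Product using (Σ; ∃; _×_)
open import Data.Sum using (_⊎_)
open import Relation.Binary.PropositionalEquality using (_≡_; _≢_)
open import Relation.Nullary using (¬_)
open import Function.Bundles using (_⇔_)

HasCard : (ℕ → Set) → ℕ → Set
HasCard P n = Σ (List ℕ) λ xs → Unique xs × length xs ≡ n × (∀ a → (a ∈ xs ⇔ P a))

infix 4 _≡_[mod_]
_≡_[mod_] : ℕ → ℕ → ℕ → Set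
a ≡ b [mod q ] = (∃ λ k → a ≡ b + k * q) ⊎ (∃ λ k → b ≡ a + k * q)

IsOrderOf2 : ℕ → ℕ → Set
IsOrderOf2 q r = 1 ≤ r × (2 ^ r ≡ 1 [mod q ]) × (∀ s → 1 ≤ s → s < r → ¬ (2 ^ s ≡ 1 [mod q ]))

-- Residue classes modulo q are represented by their least nonnegative representative a < q.
-- Bad classes E(q) = {1, 2, ..., 2^(r-1)} mod q.
Bad : ℕ → ℕ → ℕ → Set
Bad q r a = ∃ λ i → i < r × (2 ^ i ≡ a [mod q ])

SemiBad : ℕ → ℕ → ℕ → Set
SemiBad q r a = a < q × Coprime a q × ¬ Bad q r a × Bad q r (a * a)

TwoIsSquareMod : ℕ → Set
TwoIsSquareMod q = ∃ λ x → x * x ≡ 2 [mod q ]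

IsOmega : ℕ → ℕ → Set
IsOmega q w = HasCard (λ p → Prime p × p ∣ q) w

module Submission where

-- Let SquareInE = { a < q : a² ∈ E(q) }.  A class of E(q) squares into E(q), and a
-- class whose square is a power of 2 is a unit, so SquareInE is the disjoint union
-- of the N semi-bad classes and the r classes of E(q): |SquareInE| = N + r.
-- On the other hand SquareInE is a union of cosets of the group of square roots of
-- 1: if b is a unit and b^j·b^j ≡ 2^(e j), where e enumerates injectively (j < m)
-- the exponents i < r for which 2^i is a square, then (j , u) ↦ u·b^j is a
-- bijection from {j < m} × {u : u² ≡ 1} onto SquareInE.  If 2 ≡ s² take b = s,
-- m = r, e j = j; otherwise r is even (else 2 ≡ 2^(r+1) is a square) and 2^i is a
-- square only for even i, so take b = 2, m = r/2, e j = 2j.  Finally there are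
-- 2^ω(q) square roots of 1: two modulo each odd prime power, multiplied by the
-- Chinese remainder theorem.  Comparing the two counts and some arithmetic with
-- halves gives the closed forms.

open import Defs
open import Data.Nat using (ℕ; zero; suc; _+_; _*_; _∸_; _^_; _≤_; _<_; z≤n; s≤s; NonZero; >-nonZero; >-nonZero⁻¹; ≢-nonZero; ≢-nonZero⁻¹; nonTrivial⇒n>1)
open import Data.Nat.Properties
open import Data.Nat.DivMod
open import Data.Nat.Divisibility
open import Data.Nat.Coprimality using (Coprime; coprime-divisor; coprime-factors; coprime-Bézout) renaming (sym to ⊥-sym)
open import Data.Nat.GCD using (module Bézout)
open import Data.Nat.Primality using (Prime; prime; prime⇒irreducible; prime⇒nonZero)
open import Data.Nat.Primality.Factorisation using (factorise)
open import Data.Nat.ListAction using (product)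
open import Data.Nat.Tactic.RingSolver using (solve-∀)
open import Data.List using (List; []; _∷_; length; map; _++_; upTo; cartesianProduct)
open import Data.List.Properties using (length-map; length-++; length-upTo)
open import Data.List.Membership.Propositional using (_∈_)
open import Data.List.Membership.Propositional.Properties using (∈-length; ∈-map⁺; ∈-map⁻; ++-∈⇔; ∈-upTo⁺; ∈-upTo⁻; ∈-cartesianProduct⁺; ∈-cartesianProduct⁻)
open import Data.List.Membership.Propositional.Properties.WithK using (unique∧set⇒bag)
open import Data.List.Relation.Binary.BagAndSetEquality using (∼bag⇒↭)
open import Data.List.Relation.Binary.Permutation.Propositional.Properties using (↭-length)
open import Data.List.Relation.Unary.Any using (here; there)
open import Data.List.Relation.Unary.All as All using (All; []; _∷_)
open import Data.List.Relation.Unary.Unique.Propositional using (Unique; []; _∷_)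
open import Data.List.Relation.Unary.Unique.Propositional.Properties using (++⁺; upTo⁺; cartesianProduct⁺)
open import Data.Product using (Σ; ∃; ∃₂; _×_; _,_; proj₁; proj₂; uncurry)
open import Data.Sum using (_⊎_; inj₁; inj₂) renaming (map to ⊎-map)
open import Data.Empty using (⊥; ⊥-elim)
open import Function using (_∘_)
open import Function.Bundles using (_⇔_; mk⇔; Equivalence)
import Function.Properties.Equivalence as ⇔
open import Relation.Binary.PropositionalEquality
open import Relation.Nullary using (¬_; Dec; yes; no; contradiction)
open import Relation.Binary using (tri<; tri≈; tri>)
import Relation.Nullary.Decidable as Decidable

Card : {A : Set} → (A → Set) → ℕ → Set
Card {A} P n = Σ (List A) λ xs → Unique xs × length xs ≡ n × (∀ a → a ∈ xs ⇔ P a)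

module _ {A : Set} where

  -- Cardinality is well defined: two duplicate-free enumerations of the same
  -- predicate are permutations of each other.
  card-unique : {P : A → Set} {n m : ℕ} → Card P n → Card P m → n ≡ m
  card-unique (xs , xs! , refl , xs⇔) (ys , ys! , refl , ys⇔) =
    ↭-length (∼bag⇒↭ (unique∧set⇒bag xs! ys! λ {a} → ⇔.trans (xs⇔ a) (⇔.sym (ys⇔ a))))

  card-resp : {P Q : A → Set} {n : ℕ} → (∀ a → P a ⇔ Q a) → Card P n → Card Q n
  card-resp P⇔Q (xs , xs! , len , xs⇔) = xs , xs! , len , λ a → ⇔.trans (xs⇔ a) (P⇔Q a)

  card-⊎ : {P Q : A → Set} {n m : ℕ} → Card P n → Card Q m → (∀ {a} → P a → Q a → ⊥) →
           Card (λ a → P a ⊎ Q a) (n + m)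
  card-⊎ (xs , xs! , refl , xs⇔) (ys , ys! , refl , ys⇔) disjoint =
    xs ++ ys , ++⁺ xs! ys! (λ {a} (a∈xs , a∈ys) → disjoint (to (xs⇔ a) a∈xs) (to (ys⇔ a) a∈ys)) ,
    length-++ xs , λ a → ⇔.trans ++-∈⇔ (mk⇔ (⊎-map (to (xs⇔ a)) (to (ys⇔ a))) (⊎-map (from (xs⇔ a)) (from (ys⇔ a))))
    where open Equivalence

  -- Mapping a duplicate-free list by a function injective on its members
  -- creates no duplicates (the library version needs global injectivity).
  map-unique : {B : Set} (f : A → B) {xs : List A} → Unique xs →
               (∀ {x y} → x ∈ xs → y ∈ xs → f x ≡ f y → x ≡ y) → Unique (map f xs)
  map-unique f {[]} [] inj = []
  map-unique f {x ∷ xs} (x∉xs ∷ xs!) inj =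
    All.tabulate (λ b∈ fx≡b → let (y , y∈ , b≡fy) = ∈-map⁻ f b∈ in
                    All.lookup x∉xs y∈ (inj (here refl) (there y∈) (trans fx≡b b≡fy)))
    ∷ map-unique f xs! (λ x∈ y∈ → inj (there x∈) (there y∈))

  card-image : {B : Set} {P : A → Set} {Q : B → Set} {n : ℕ} (f : A → B) → Card P n →
               (∀ {x y} → P x → P y → f x ≡ f y → x ≡ y) →
               (∀ b → Q b ⇔ ∃ λ a → P a × b ≡ f a) → Card Q n
  card-image f (xs , xs! , len , xs⇔) inj Q⇔image =
    map f xs ,
    map-unique f xs! (λ x∈ y∈ → inj (to (xs⇔ _) x∈) (to (xs⇔ _) y∈)) ,
    trans (length-map f xs) len ,
    λ b → mk⇔ (λ b∈ → let (a , a∈ , b≡fa) = ∈-map⁻ f b∈ in from (Q⇔image b) (a , to (xs⇔ a) a∈ , b≡fa))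
              (λ Qb → let (a , Pa , b≡fa) = to (Q⇔image b) Qb in subst (_∈ map f xs) (sym b≡fa) (∈-map⁺ f (from (xs⇔ a) Pa)))
    where open Equivalence

length-cartesianProduct : {A B : Set} (xs : List A) (ys : List B) →
                          length (cartesianProduct xs ys) ≡ length xs * length ys
length-cartesianProduct [] ys = refl
length-cartesianProduct (x ∷ xs) ys = begin
  length (map (x ,_) ys ++ cartesianProduct xs ys)  ≡⟨ length-++ (map (x ,_) ys) ⟩
  length (map (x ,_) ys) + length (cartesianProduct xs ys)
    ≡⟨ cong₂ _+_ (length-map (x ,_) ys) (length-cartesianProduct xs ys) ⟩
  length ys + length xs * length ys  ∎
  where open ≡-Reasoning

card-× : {A B : Set} {P : A → Set} {Q : B → Set} {n m : ℕ} → Card P n → Card Q m →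
         Card (λ (ab : A × B) → P (proj₁ ab) × Q (proj₂ ab)) (n * m)
card-× (xs , xs! , refl , xs⇔) (ys , ys! , refl , ys⇔) =
  cartesianProduct xs ys , cartesianProduct⁺ xs! ys! , length-cartesianProduct xs ys ,
  λ (a , b) → mk⇔ (λ ab∈ → let (a∈ , b∈) = ∈-cartesianProduct⁻ xs ys ab∈ in to (xs⇔ a) a∈ , to (ys⇔ b) b∈)
                  (λ (Pa , Qb) → ∈-cartesianProduct⁺ (from (xs⇔ a) Pa) (from (ys⇔ b) Qb))
  where open Equivalence

card-< : ∀ n → Card (_< n) n
card-< n = upTo n , upTo⁺ n , length-upTo n , λ a → mk⇔ ∈-upTo⁻ ∈-upTo⁺

module Modulo (q : ℕ) .{{q≢0 : NonZero q}} where

  infix 4 _≈_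
  _≈_ : ℕ → ℕ → Set
  a ≈ b = a % q ≡ b % q

  ≈-reflexive : ∀ {a b} → a ≡ b → a ≈ b
  ≈-reflexive = cong (_% q)

  %-≈ : ∀ a → a % q ≈ a
  %-≈ a = m%n%n≡m%n a q

  ≈-reduced : ∀ {a b} → a < q → b < q → a ≈ b → a ≡ b
  ≈-reduced {a} {b} a<q b<q a≈b = trans (sym (m<n⇒m%n≡m a<q)) (trans a≈b (m<n⇒m%n≡m b<q))

  +-multiple : ∀ a k → a + k * q ≈ a
  +-multiple a k = [m+kn]%n≡m%n a k q

  multiple≈0 : ∀ k → k * q ≈ 0
  multiple≈0 k = +-multiple 0 k

  *-cong : ∀ {a a′ b b′} → a ≈ a′ → b ≈ b′ → a * b ≈ a′ * b′
  *-cong {a} {a′} {b} {b′} a≈a′ b≈b′ = begin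
    (a * b) % q                ≡⟨ %-distribˡ-* a b q ⟩
    ((a % q) * (b % q)) % q    ≡⟨ cong₂ (λ x y → (x * y) % q) a≈a′ b≈b′ ⟩
    ((a′ % q) * (b′ % q)) % q  ≡⟨ sym (%-distribˡ-* a′ b′ q) ⟩
    (a′ * b′) % q              ∎
    where open ≡-Reasoning

  +-cong : ∀ {a a′ b b′} → a ≈ a′ → b ≈ b′ → a + b ≈ a′ + b′
  +-cong {a} {a′} {b} {b′} a≈a′ b≈b′ = begin
    (a + b) % q                ≡⟨ %-distribˡ-+ a b q ⟩
    ((a % q) + (b % q)) % q    ≡⟨ cong₂ (λ x y → (x + y) % q) a≈a′ b≈b′ ⟩
    ((a′ % q) + (b′ % q)) % q  ≡⟨ sym (%-distribˡ-+ a′ b′ q) ⟩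
    (a′ + b′) % q              ∎
    where open ≡-Reasoning

  ^-cong : ∀ {a b} k → a ≈ b → a ^ k ≈ b ^ k
  ^-cong zero    a≈b = refl
  ^-cong (suc k) a≈b = *-cong a≈b (^-cong k a≈b)

  ∣∸⇒≈ : ∀ {a b} → a ≤ b → q ∣ b ∸ a → a ≈ b
  ∣∸⇒≈ {a} {b} a≤b (divides k b∸a≡kq) = begin
    a % q                ≡⟨ sym (+-multiple a k) ⟩
    (a + k * q) % q      ≡⟨ cong (λ x → (a + x) % q) (sym b∸a≡kq) ⟩
    (a + (b ∸ a)) % q    ≡⟨ cong (_% q) (m+[n∸m]≡n a≤b) ⟩
    b % q                ∎
    where open ≡-Reasoning

  ≈⇒∣∸ : ∀ {a b} → a ≤ b → a ≈ b → q ∣ b ∸ a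
  ≈⇒∣∸ {a} {b} a≤b a≈b = divides (b / q ∸ a / q) (begin
    b ∸ a                                      ≡⟨ cong₂ _∸_ (m≡m%n+[m/n]*n b q) (m≡m%n+[m/n]*n a q) ⟩
    (b % q + b / q * q) ∸ (a % q + a / q * q)  ≡⟨ cong (λ x → (b % q + b / q * q) ∸ (x + a / q * q)) a≈b ⟩
    (b % q + b / q * q) ∸ (b % q + a / q * q)  ≡⟨ [m+n]∸[m+o]≡n∸o (b % q) _ _ ⟩
    b / q * q ∸ a / q * q                      ≡⟨ sym (*-distribʳ-∸ q (b / q) (a / q)) ⟩
    (b / q ∸ a / q) * q                        ∎)
    where open ≡-Reasoning

  mod⇒≈ : ∀ {a b} → a ≡ b [mod q ] → a ≈ b
  mod⇒≈ (inj₁ (k , refl)) = +-multiple _ k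
  mod⇒≈ (inj₂ (k , refl)) = sym (+-multiple _ k)

  ≈⇒mod : ∀ {a b} → a ≈ b → a ≡ b [mod q ]
  ≈⇒mod {a} {b} a≈b with a ≤? b
  ... | yes a≤b = let divides k b∸a≡kq = ≈⇒∣∸ a≤b a≈b in
                  inj₂ (k , trans (sym (m+[n∸m]≡n a≤b)) (cong (a +_) b∸a≡kq))
  ... | no a≰b  = let b≤a = ≰⇒≥ a≰b ; divides k a∸b≡kq = ≈⇒∣∸ b≤a (sym a≈b) in
                  inj₁ (k , trans (sym (m+[n∸m]≡n b≤a)) (cong (b +_) a∸b≡kq))

  Unit : ℕ → Set
  Unit a = ∃ λ a⁻¹ → a * a⁻¹ ≈ 1

  unit-* : ∀ {a b} → Unit a → Unit b → Unit (a * b)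
  unit-* {a} {b} (a⁻¹ , aa⁻¹≈1) (b⁻¹ , bb⁻¹≈1) =
    a⁻¹ * b⁻¹ , trans (≈-reflexive (regroup a b a⁻¹ b⁻¹)) (*-cong aa⁻¹≈1 bb⁻¹≈1)
    where regroup : ∀ a b c d → a * b * (c * d) ≡ (a * c) * (b * d)
          regroup = solve-∀

  unit-^ : ∀ {a} k → Unit a → Unit (a ^ k)
  unit-^ zero    u = 1 , refl
  unit-^ {a} (suc k) u = unit-* {a} {a ^ k} u (unit-^ k u)

  cancel : ∀ {c x y} → Unit c → c * x ≈ c * y → x ≈ y
  cancel {c} {x} {y} (d , cd≈1) cx≈cy = begin
    x % q            ≡⟨ ≈-reflexive (sym (*-identityˡ x)) ⟩
    (1 * x) % q      ≡⟨ *-cong (sym cd≈1) (refl {x = x % q}) ⟩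
    (c * d * x) % q  ≡⟨ ≈-reflexive (reassociate c d x) ⟩
    (d * (c * x)) % q ≡⟨ *-cong (refl {x = d % q}) cx≈cy ⟩
    (d * (c * y)) % q ≡⟨ ≈-reflexive (sym (reassociate c d y)) ⟩
    (c * d * y) % q  ≡⟨ *-cong cd≈1 (refl {x = y % q}) ⟩
    (1 * y) % q      ≡⟨ ≈-reflexive (*-identityˡ y) ⟩
    y % q            ∎
    where open ≡-Reasoning
          reassociate : ∀ c d x → c * d * x ≡ d * (c * x)
          reassociate = solve-∀

  -- If 1 + u is a multiple of q then u ≡ -1, whose inverse is q - 1.
  ≡-1⇒unit : ∀ u k → 1 + u ≡ k * q → u * (q ∸ 1) ≈ 1
  ≡-1⇒unit u k 1+u≡kq = begin
    (u * (q ∸ 1)) % q                ≡⟨ sym (+-multiple (u * (q ∸ 1)) k) ⟩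
    (u * (q ∸ 1) + k * q) % q        ≡⟨ cong (λ z → (u * (q ∸ 1) + z) % q) (sym 1+u≡kq) ⟩
    (u * (q ∸ 1) + (1 + u)) % q      ≡⟨ cong (_% q) (expand u (q ∸ 1)) ⟩
    (1 + u * (q ∸ 1 + 1)) % q        ≡⟨ cong (λ z → (1 + u * z) % q) (m∸n+n≡m (>-nonZero⁻¹ q)) ⟩
    (1 + u * q) % q                  ≡⟨ +-multiple 1 u ⟩
    1 % q                            ∎
    where open ≡-Reasoning
          expand : ∀ u p → u * p + (1 + u) ≡ 1 + u * (p + 1)
          expand = solve-∀

  -- Units are coprime to the modulus: a common divisor of c and q divides c·c⁻¹ mod q = 1.
  unit⇒coprime : ∀ {c} → Unit c → Coprime c q
  unit⇒coprime {c} (c⁻¹ , cc⁻¹≈1) (d∣c , d∣q) =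
    ∣1⇒≡1 (∣n∣m%n⇒∣m d∣q (subst (_ ∣_) cc⁻¹≈1 (%-presˡ-∣ (∣m⇒∣m*n c⁻¹ d∣c) d∣q)))
prime≥2 : ∀ {p} → Prime p → 2 ≤ p
prime≥2 {p} (prime _) = nonTrivial⇒n>1 p

prime⇒coprime : ∀ {p m} → Prime p → ¬ p ∣ m → Coprime p m
prime⇒coprime pp p∤m {d} (d∣p , d∣m) with prime⇒irreducible pp d∣p
... | inj₁ d≡1  = d≡1
... | inj₂ refl = contradiction d∣m p∤m

coprime-* : ∀ {a b m} → Coprime a m → Coprime b m → Coprime (a * b) m
coprime-* {b = b} a⊥m b⊥m (d∣ab , d∣m) = b⊥m (coprime-factors a⊥m (d∣ab , ∣m⇒∣m*n b d∣m) , d∣m)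

coprime-^ : ∀ {a m} k → Coprime a m → Coprime (a ^ k) m
coprime-^ zero    a⊥m (d∣1 , _) = ∣1⇒≡1 d∣1
coprime-^ (suc k) a⊥m = coprime-* a⊥m (coprime-^ k a⊥m)

coprime-∣* : ∀ {a b n} → Coprime a b → a ∣ n → b ∣ n → a * b ∣ n
coprime-∣* {a} {b} a⊥b (divides k refl) b∣ka
  with coprime-divisor (⊥-sym a⊥b) (subst (b ∣_) (*-comm k a) b∣ka)
... | divides j refl = divides j (regroup j a b)
  where regroup : ∀ j a b → j * b * a ≡ j * (a * b)
        regroup = solve-∀

prime-factor : ∀ n → 2 ≤ n → ∃ λ p → Prime p × p ∣ n
prime-factor n@(suc _) n≥2 with factorise n
... | record { factors = [] ; isFactorisation = n≡1 } = ⊥-elim (<⇒≢ n≥2 (sym n≡1))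
... | record { factors = p ∷ ps ; isFactorisation = n≡∏ ; factorsPrime = pp ∷ _ } =
  p , pp , subst (p ∣_) (sym n≡∏) (m∣m*n (product ps))

-- Splitting off the p-part of n ≠ 0: n = p^k · m with p ∤ m.  The recursion
-- divides by p and is bounded by the size of n.
p-part : ∀ p n → 2 ≤ p → .{{NonZero n}} → ∃₂ λ k m → n ≡ p ^ k * m × ¬ p ∣ m
p-part p n p≥2 = go n n ≤-refl
  where
    go : ∀ bound n .{{_ : NonZero n}} → n ≤ bound → ∃₂ λ k m → n ≡ p ^ k * m × ¬ p ∣ m
    go zero n@(suc _) ()
    go (suc bound) n n≤bound with p ∣? n
    ... | no p∤n = 0 , n , sym (+-identityʳ n) , p∤n
    ... | yes (divides c refl) =
      let instance c≢0 = m*n≢0⇒m≢0 c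
          (k , m , c≡pᵏm , p∤m) = go bound c (≤-pred (≤-trans (m<m*n c p p≥2) n≤bound))
      in suc k , m , trans (cong (_* p) c≡pᵏm) (regroup p (p ^ k) m) , p∤m
      where regroup : ∀ p a m → a * m * p ≡ p * a * m
            regroup = solve-∀

Root : ℕ → ℕ → Set
Root q x = x < q × x * x ≡ 1 [mod q ]

roots-mod-1 : Card (Root 1) 1
roots-mod-1 = 0 ∷ [] , [] ∷ [] , refl , λ x → mk⇔ (root x) (listed x)
  where
    root : ∀ x → x ∈ 0 ∷ [] → Root 1 x
    root x (here refl) = s≤s z≤n , inj₂ (1 , refl)
    listed : ∀ x → Root 1 x → x ∈ 0 ∷ []
    listed zero    _              = here refl
    listed (suc x) (s≤s () , _)

-- Modulo Q ≥ 3 the square roots of 1 are exactly ±1, provided Q ∣ y(y+2) forces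
-- Q ∣ y or Q ∣ y+2 (note (y+1)² - 1 = y(y+2)).
roots-±1 : ∀ Q → 3 ≤ Q → (∀ y → Q ∣ y * (y + 2) → Q ∣ y ⊎ Q ∣ y + 2) → Card (Root Q) 2
roots-±1 (suc zero)       (s≤s ())
roots-±1 (suc (suc zero)) (s≤s (s≤s ()))
roots-±1 Q@(suc (suc (suc t))) _ split =
  1 ∷ Q-1 ∷ [] , ((λ ()) ∷ []) ∷ [] ∷ [] , refl , λ x → mk⇔ (root x) (listed x)
  where
    open Modulo Q
    Q-1 = suc (suc t)
    square-of-Q-1 : ∀ t → suc (suc t) * suc (suc t) ≡ 1 + suc t * suc (suc (suc t))
    square-of-Q-1 = solve-∀
    root : ∀ x → x ∈ 1 ∷ Q-1 ∷ [] → Root Q x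
    root x (here refl)         = s≤s (s≤s z≤n) , inj₁ (0 , refl)
    root x (there (here refl)) = ≤-refl , inj₁ (suc t , square-of-Q-1 t)
    square-of-suc : ∀ y → suc y * suc y ≡ 1 + y * (y + 2)
    square-of-suc = solve-∀
    listed : ∀ x → Root Q x → x ∈ 1 ∷ Q-1 ∷ []
    listed zero    (_ , 0≡1) with mod⇒≈ 0≡1
    ... | ()
    listed (suc y) (1+y<Q , root)
      with split y (subst (Q ∣_) (cong (_∸ 1) (square-of-suc y)) (≈⇒∣∸ (s≤s z≤n) (sym (mod⇒≈ root))))
    ... | inj₁ Q∣y with y
    ...   | zero   = here refl
    ...   | suc y′ = ⊥-elim (<⇒≱ (<-trans (n<1+n (suc y′)) 1+y<Q) (∣⇒≤ Q∣y))
    listed (suc y) (1+y<Q , root) | inj₂ Q∣y+2 =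
      there (here (suc-injective (≤-antisym 1+y<Q (subst (Q ≤_) (+-comm y 2) (∣⇒≤ {{y+2≢0}} Q∣y+2)))))
      where y+2≢0 : NonZero (y + 2)
            y+2≢0 = subst NonZero (+-comm 2 y) _

-- Modulo an odd prime power the square roots of 1 are ±1: the odd prime p cannot
-- divide both y and y + 2, so p^(k+1) divides one of them entirely.
roots-odd-prime-power : ∀ {p} k → Prime p → p ≢ 2 → Card (Root (p ^ suc k)) 2
roots-odd-prime-power {p} k pp p≢2 = roots-±1 (p ^ suc k) pᵏ⁺¹≥3 split
  where
    instance p≢0 = prime⇒nonZero pp
    pᵏ⁺¹≥3 : 3 ≤ p ^ suc k
    pᵏ⁺¹≥3 = ≤-trans (≤∧≢⇒< (prime≥2 pp) (p≢2 ∘ sym)) (m≤m*n p (p ^ k) {{m^n≢0 p k}})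
    split : ∀ y → p ^ suc k ∣ y * (y + 2) → p ^ suc k ∣ y ⊎ p ^ suc k ∣ y + 2
    split y pᵏ⁺¹∣y[y+2] with p ∣? y
    ... | yes p∣y = inj₁ (coprime-divisor (coprime-^ (suc k) (prime⇒coprime pp p∤y+2))
                                          (subst (p ^ suc k ∣_) (*-comm y (y + 2)) pᵏ⁺¹∣y[y+2]))
      where p∤y+2 : ¬ p ∣ y + 2
            p∤y+2 p∣y+2 = p≢2 (≤-antisym (∣⇒≤ (∣m+n∣m⇒∣n p∣y+2 p∣y)) (prime≥2 pp))
    ... | no p∤y = inj₂ (coprime-divisor (coprime-^ (suc k) (prime⇒coprime pp p∤y)) pᵏ⁺¹∣y[y+2])

-- For coprime a and b some e is ≡ 0 (mod a) and ≡ 1 (mod b): from a Bézout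
-- identity, e = x·a when x·a ≡ 1 (mod b), and e = x·a·(b-1) when x·a ≡ -1 (mod b).
crt-idempotent : ∀ a b .{{_ : NonZero a}} .{{_ : NonZero b}} → Coprime a b →
                 ∃ λ e → Modulo._≈_ a e 0 × Modulo._≈_ b e 1
crt-idempotent a b a⊥b with coprime-Bézout a⊥b
... | Bézout.+- x y 1+yb≡xa =
  x * a , A.multiple≈0 x , trans (cong (_% b) (sym 1+yb≡xa)) (B.+-multiple 1 y)
  where module A = Modulo a ; module B = Modulo b
... | Bézout.-+ x y 1+xa≡yb =
  x * a * (b ∸ 1) , trans (cong (_% a) (regroup x a (b ∸ 1))) (A.multiple≈0 (x * (b ∸ 1))) ,
  B.≡-1⇒unit (x * a) y 1+xa≡yb
  where module A = Modulo a ; module B = Modulo b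
        regroup : ∀ x a c → x * a * c ≡ x * c * a
        regroup = solve-∀

module CRT (a b : ℕ) .{{a≢0 : NonZero a}} .{{b≢0 : NonZero b}} (a⊥b : Coprime a b) where

  instance ab≢0 = m*n≢0 a b
  module A  = Modulo a
  module B  = Modulo b
  module AB = Modulo (a * b)

  e₁ : ℕ
  e₁ = proj₁ (crt-idempotent b a (⊥-sym a⊥b))
  e₁≈ᵃ1 : e₁ A.≈ 1
  e₁≈ᵃ1 = proj₂ (proj₂ (crt-idempotent b a (⊥-sym a⊥b)))
  e₁≈ᵇ0 : e₁ B.≈ 0
  e₁≈ᵇ0 = proj₁ (proj₂ (crt-idempotent b a (⊥-sym a⊥b)))

  e₂ : ℕ
  e₂ = proj₁ (crt-idempotent a b a⊥b)
  e₂≈ᵃ0 : e₂ A.≈ 0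
  e₂≈ᵃ0 = proj₁ (proj₂ (crt-idempotent a b a⊥b))
  e₂≈ᵇ1 : e₂ B.≈ 1
  e₂≈ᵇ1 = proj₂ (proj₂ (crt-idempotent a b a⊥b))

  crt : ℕ → ℕ → ℕ
  crt y z = (y * e₁ + z * e₂) % (a * b)

  crt< : ∀ y z → crt y z < a * b
  crt< y z = m%n<n _ (a * b)

  AB⇒A : ∀ {u v} → u AB.≈ v → u A.≈ v
  AB⇒A {u} {v} u≈v = trans (sym (m∣n⇒o%n%m≡o%m a (a * b) u (m∣m*n b)))
                      (trans (cong (_% a) u≈v) (m∣n⇒o%n%m≡o%m a (a * b) v (m∣m*n b)))

  AB⇒B : ∀ {u v} → u AB.≈ v → u B.≈ v
  AB⇒B {u} {v} u≈v = trans (sym (m∣n⇒o%n%m≡o%m b (a * b) u (n∣m*n a)))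
                      (trans (cong (_% b) u≈v) (m∣n⇒o%n%m≡o%m b (a * b) v (n∣m*n a)))

  A×B⇒AB : ∀ {u v} → u A.≈ v → u B.≈ v → u AB.≈ v
  A×B⇒AB {u} {v} u≈ᵃv u≈ᵇv with u ≤? v
  ... | yes u≤v = AB.∣∸⇒≈ u≤v (coprime-∣* a⊥b (A.≈⇒∣∸ u≤v u≈ᵃv) (B.≈⇒∣∸ u≤v u≈ᵇv))
  ... | no u≰v  = let v≤u = ≰⇒≥ u≰v in
                  sym (AB.∣∸⇒≈ v≤u (coprime-∣* a⊥b (A.≈⇒∣∸ v≤u (sym u≈ᵃv)) (B.≈⇒∣∸ v≤u (sym u≈ᵇv))))

  crt-a : ∀ y z → crt y z A.≈ y
  crt-a y z = begin
    crt y z % a              ≡⟨ AB⇒A (AB.%-≈ (y * e₁ + z * e₂)) ⟩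
    (y * e₁ + z * e₂) % a    ≡⟨ A.+-cong (A.*-cong (refl {x = y % a}) e₁≈ᵃ1) (A.*-cong (refl {x = z % a}) e₂≈ᵃ0) ⟩
    (y * 1 + z * 0) % a      ≡⟨ cong (_% a) (simplify y z) ⟩
    y % a                    ∎
    where open ≡-Reasoning
          simplify : ∀ y z → y * 1 + z * 0 ≡ y
          simplify = solve-∀

  crt-b : ∀ y z → crt y z B.≈ z
  crt-b y z = begin
    crt y z % b              ≡⟨ AB⇒B (AB.%-≈ (y * e₁ + z * e₂)) ⟩
    (y * e₁ + z * e₂) % b    ≡⟨ B.+-cong (B.*-cong (refl {x = y % b}) e₁≈ᵇ0) (B.*-cong (refl {x = z % b}) e₂≈ᵇ1) ⟩
    (y * 0 + z * 1) % b      ≡⟨ cong (_% b) (simplify y z) ⟩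
    z % b                    ∎
    where open ≡-Reasoning
          simplify : ∀ y z → y * 0 + z * 1 ≡ z
          simplify = solve-∀

  roots-crt : ∀ {s t} → Card (Root a) s → Card (Root b) t → Card (Root (a * b)) (s * t)
  roots-crt rootsᵃ rootsᵇ = card-image (uncurry crt) (card-× rootsᵃ rootsᵇ) injective image
    where
      injective : ∀ {yz yz′} → Root a (proj₁ yz) × Root b (proj₂ yz) → Root a (proj₁ yz′) × Root b (proj₂ yz′) →
                  uncurry crt yz ≡ uncurry crt yz′ → yz ≡ yz′
      injective {y , z} {y′ , z′} ((y<a , _) , (z<b , _)) ((y′<a , _) , (z′<b , _)) same =
        cong₂ _,_ (A.≈-reduced y<a y′<a (trans (sym (crt-a y z)) (trans (cong (_% a) same) (crt-a y′ z′))))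
                  (B.≈-reduced z<b z′<b (trans (sym (crt-b y z)) (trans (cong (_% b) same) (crt-b y′ z′))))
      image : ∀ c → Root (a * b) c ⇔ ∃ λ yz → (Root a (proj₁ yz) × Root b (proj₂ yz)) × c ≡ uncurry crt yz
      image c = mk⇔ decompose compose
        where
          decompose : Root (a * b) c → ∃ λ yz → (Root a (proj₁ yz) × Root b (proj₂ yz)) × c ≡ uncurry crt yz
          decompose (c<ab , c²≡1) =
            (c % a , c % b) ,
            (  (m%n<n c a , A.≈⇒mod (trans (A.*-cong (A.%-≈ c) (A.%-≈ c)) (AB⇒A (AB.mod⇒≈ c²≡1))))
             , (m%n<n c b , B.≈⇒mod (trans (B.*-cong (B.%-≈ c) (B.%-≈ c)) (AB⇒B (AB.mod⇒≈ c²≡1))))) ,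
            AB.≈-reduced c<ab (crt< (c % a) (c % b))
              (A×B⇒AB (sym (trans (crt-a (c % a) (c % b)) (A.%-≈ c))) (sym (trans (crt-b (c % a) (c % b)) (B.%-≈ c))))
          compose : (∃ λ yz → (Root a (proj₁ yz) × Root b (proj₂ yz)) × c ≡ uncurry crt yz) → Root (a * b) c
          compose ((y , z) , ((_ , y²≡1) , (_ , z²≡1)) , refl) =
            crt< y z ,
            AB.≈⇒mod (A×B⇒AB (trans (A.*-cong (crt-a y z) (crt-a y z)) (A.mod⇒≈ y²≡1))
                             (trans (B.*-cong (crt-b y z) (crt-b y z)) (B.mod⇒≈ z²≡1)))

-- A prime dividing p^k·m with p ∤ m is either p or divides m; so the prime
-- divisors of the cofactor m are those of p^k·m other than p.
cofactor-primes : ∀ {p q k m rest} → Prime p → q ≡ p ^ k * m → ¬ p ∣ m → All (p ≢_) rest →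
                  (∀ a → a ∈ p ∷ rest ⇔ (Prime a × a ∣ q)) → ∀ a → a ∈ rest ⇔ (Prime a × a ∣ m)
cofactor-primes {p} {q} {k} {m} {rest} pp q≡pᵏm p∤m p∉rest primes a = mk⇔ divides-m listed
  where
    divides-m : a ∈ rest → Prime a × a ∣ m
    divides-m a∈rest with Equivalence.to (primes a) (there a∈rest)
    ... | pa , a∣q = pa , coprime-divisor (⊥-sym (coprime-^ k (prime⇒coprime pp p∤a))) (subst (a ∣_) q≡pᵏm a∣q)
      where
        p∤a : ¬ p ∣ a
        p∤a p∣a with prime⇒irreducible pa p∣a
        ... | inj₁ p≡1 = <⇒≢ (prime≥2 pp) (sym p≡1)
        ... | inj₂ p≡a = All.lookup p∉rest a∈rest p≡a
    listed : Prime a × a ∣ m → a ∈ rest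
    listed (pa , a∣m) with Equivalence.from (primes a) (pa , subst (a ∣_) (sym q≡pᵏm) (∣n⇒∣m*n (p ^ k) a∣m))
    ... | here refl  = contradiction a∣m p∤m
    ... | there a∈rest = a∈rest

-- An odd q ≠ 0 whose distinct prime divisors are listed by ps has 2^|ps| square
-- roots of 1: split off the first prime power and use the Chinese remainder theorem.
roots-count : ∀ ps q .{{_ : NonZero q}} → ¬ 2 ∣ q → Unique ps → (∀ a → a ∈ ps ⇔ (Prime a × a ∣ q)) →
              Card (Root q) (2 ^ length ps)
roots-count [] (suc zero) _ _ _ = roots-mod-1
roots-count [] q@(suc (suc _)) _ _ primes with prime-factor q (s≤s (s≤s z≤n))
... | p , pp , p∣q with Equivalence.from (primes p) (pp , p∣q)
... | ()
roots-count (p ∷ rest) q odd (p∉rest ∷ rest!) primes with Equivalence.to (primes p) (here refl)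
... | pp , p∣q with p-part p q (prime≥2 pp)
... | zero , m , q≡m , p∤m = contradiction (subst (p ∣_) (trans q≡m (+-identityʳ m)) p∣q) p∤m
... | suc k , m , q≡pᵏm , p∤m =
  subst (λ n → Card (Root n) (2 ^ length (p ∷ rest))) (sym q≡pᵏm)
    (CRT.roots-crt (p ^ suc k) m (coprime-^ (suc k) (prime⇒coprime pp p∤m))
       (roots-odd-prime-power k pp p≢2)
       (roots-count rest m m-odd rest! (cofactor-primes {k = suc k} pp q≡pᵏm p∤m p∉rest primes)))
  where
    instance
      pᵏ≢0 : NonZero (p ^ suc k)
      pᵏ≢0 = m^n≢0 p (suc k) {{prime⇒nonZero pp}}
      m≢0 : NonZero m
      m≢0 = ≢-nonZero λ { refl → ≢-nonZero⁻¹ q (trans q≡pᵏm (*-zeroʳ (p ^ suc k))) }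
    p≢2 : p ≢ 2
    p≢2 refl = odd p∣q
    m-odd : ¬ 2 ∣ m
    m-odd 2∣m = odd (subst (2 ∣_) (sym q≡pᵏm) (∣n⇒∣m*n (p ^ suc k) 2∣m))

square-^ : ∀ a j → a ^ j * a ^ j ≡ (a * a) ^ j
square-^ a zero    = refl
square-^ a (suc j) = trans (regroup a (a ^ j)) (cong (a * a *_) (square-^ a j))
  where regroup : ∀ a x → a * x * (a * x) ≡ a * a * (x * x)
        regroup = solve-∀

square-of-product : ∀ x y → (x * y) * (x * y) ≡ (x * x) * (y * y)
square-of-product = solve-∀

parity : ∀ n → ∃ λ t → n ≡ t + t ⊎ n ≡ suc (t + t)
parity zero = 0 , inj₁ refl
parity (suc n) with parity n
... | t , inj₁ n≡2t   = t , inj₂ (cong suc n≡2t)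
... | t , inj₂ n≡2t+1 = suc t , inj₁ (trans (cong suc n≡2t+1) (cong suc (sym (+-suc t t))))

double-injective : ∀ t u → t + t ≡ u + u → t ≡ u
double-injective t u 2t≡2u = *-cancelˡ-≡ t u 2 (trans (twice t) (trans 2t≡2u (sym (twice u))))
  where twice : ∀ t → 2 * t ≡ t + t
        twice = solve-∀

double-<-reflect : ∀ t u → t + t < u + u → t < u
double-<-reflect t u 2t<2u with t <? u
... | yes t<u = t<u
... | no t≮u  = ⊥-elim (<⇒≱ 2t<2u (+-mono-≤ (≮⇒≥ t≮u) (≮⇒≥ t≮u)))

module PowersOfTwo (q r : ℕ) .{{q≢0 : NonZero q}} (order : IsOrderOf2 q r) where

  open Modulo q

  r≥1 : 1 ≤ r
  r≥1 = proj₁ order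

  2ʳ≈1 : 2 ^ r ≈ 1
  2ʳ≈1 = mod⇒≈ (proj₁ (proj₂ order))

  instance r≢0 = >-nonZero r≥1

  -- 2 is a unit, with inverse 2^(r-1); hence so are its powers.
  pow-unit : ∀ k → Unit (2 ^ k)
  pow-unit k = unit-^ k two-unit
    where two-unit : Unit 2
          two-unit = 2 ^ (r ∸ 1) , trans (cong (λ x → (2 ^ x) % q) (trans (+-comm 1 (r ∸ 1)) (m∸n+n≡m r≥1))) 2ʳ≈1

  -- A coincidence 2^i ≡ 2^j with i < j < r would give 2^(j-i) ≡ 1 below the order.
  pow-incongruent : ∀ {i j} → i < j → j < r → ¬ 2 ^ i ≈ 2 ^ j
  pow-incongruent {i} {j} i<j j<r 2ⁱ≈2ʲ =
    proj₂ (proj₂ order) (j ∸ i) (m<n⇒0<n∸m i<j) (≤-<-trans (m∸n≤m j i) j<r) (≈⇒mod (sym 1≈2ʲ⁻ⁱ))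
    where
      2ʲ≡2ⁱ2ʲ⁻ⁱ : 2 ^ j ≡ 2 ^ i * 2 ^ (j ∸ i)
      2ʲ≡2ⁱ2ʲ⁻ⁱ = trans (cong (2 ^_) (sym (m+[n∸m]≡n (<⇒≤ i<j)))) (^-distribˡ-+-* 2 i (j ∸ i))
      1≈2ʲ⁻ⁱ : 1 ≈ 2 ^ (j ∸ i)
      1≈2ʲ⁻ⁱ = cancel {2 ^ i} (pow-unit i)
                 (trans (≈-reflexive (*-identityʳ (2 ^ i))) (trans 2ⁱ≈2ʲ (≈-reflexive 2ʲ≡2ⁱ2ʲ⁻ⁱ)))

  pow-injective : ∀ {i j} → i < r → j < r → 2 ^ i ≈ 2 ^ j → i ≡ j
  pow-injective {i} {j} i<r j<r 2ⁱ≈2ʲ with <-cmp i j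
  ... | tri< i<j _ _ = contradiction 2ⁱ≈2ʲ (pow-incongruent i<j j<r)
  ... | tri≈ _ i≡j _ = i≡j
  ... | tri> _ _ j<i = contradiction (sym 2ⁱ≈2ʲ) (pow-incongruent j<i i<r)

  pow-reduce : ∀ n → 2 ^ n ≈ 2 ^ (n % r)
  pow-reduce n = begin
    (2 ^ n) % q                                ≡⟨ cong (λ x → (2 ^ x) % q) n≡n%r+r[n/r] ⟩
    (2 ^ (n % r + r * (n / r))) % q            ≡⟨ ≈-reflexive (trans (^-distribˡ-+-* 2 (n % r) _)
                                                    (cong (2 ^ (n % r) *_) (sym (^-*-assoc 2 r (n / r))))) ⟩
    (2 ^ (n % r) * (2 ^ r) ^ (n / r)) % q      ≡⟨ *-cong (refl {x = 2 ^ (n % r) % q}) 2ʳᵏ≈1 ⟩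
    (2 ^ (n % r) * 1) % q                      ≡⟨ ≈-reflexive (*-identityʳ _) ⟩
    (2 ^ (n % r)) % q                          ∎
    where open ≡-Reasoning
          2ʳᵏ≈1 : (2 ^ r) ^ (n / r) ≈ 1
          2ʳᵏ≈1 = trans (^-cong (n / r) 2ʳ≈1) (≈-reflexive (^-zeroˡ (n / r)))
          n≡n%r+r[n/r] : n ≡ n % r + r * (n / r)
          n≡n%r+r[n/r] = trans (m≡m%n+[m/n]*n n r) (cong (n % r +_) (*-comm (n / r) r))

  bad⇔ : ∀ a → Bad q r a ⇔ (∃ λ i → i < r × 2 ^ i ≈ a)
  bad⇔ a = mk⇔ (λ (i , i<r , 2ⁱ≡a) → i , i<r , mod⇒≈ 2ⁱ≡a) (λ (i , i<r , 2ⁱ≈a) → i , i<r , ≈⇒mod 2ⁱ≈a)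

  bad? : ∀ a → Dec (Bad q r a)
  bad? a = Decidable.map (⇔.sym (bad⇔ a)) (anyUpTo? (λ i → (2 ^ i) % q ≟ a % q) r)

  bad-square : ∀ {a} → Bad q r a → Bad q r (a * a)
  bad-square {a} b with Equivalence.to (bad⇔ a) b
  ... | i , _ , 2ⁱ≈a = Equivalence.from (bad⇔ (a * a))
    ((i + i) % r , m%n<n (i + i) r ,
     trans (sym (pow-reduce (i + i))) (trans (≈-reflexive (^-distribˡ-+-* 2 i i)) (*-cong 2ⁱ≈a 2ⁱ≈a)))

  square-unit : ∀ {a i} → a * a ≈ 2 ^ i → Unit a
  square-unit {a} {i} a²≈2ⁱ with pow-unit i
  ... | d , 2ⁱd≈1 = a * d , trans (≈-reflexive (sym (*-assoc a a d))) (trans (*-cong a²≈2ⁱ (refl {x = d % q})) 2ⁱd≈1)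

  bad-card : Card (λ a → a < q × Bad q r a) r
  bad-card = card-image (λ i → (2 ^ i) % q) (card-< r)
    pow-injective
    λ a → mk⇔ (λ (a<q , b) → let (i , i<r , 2ⁱ≈a) = Equivalence.to (bad⇔ a) b in
                              i , i<r , ≈-reduced a<q (m%n<n _ q) (trans (sym 2ⁱ≈a) (sym (%-≈ (2 ^ i)))))
              (λ { (i , i<r , refl) → m%n<n _ q , Equivalence.from (bad⇔ _) (i , i<r , sym (%-≈ (2 ^ i))) })

  SquareInE : ℕ → Set
  SquareInE a = a < q × Bad q r (a * a)

  -- SquareInE is the disjoint union of the semi-bad classes and E(q): a class of
  -- E(q) squares into E(q), and a class squaring into E(q) is a unit.
  squareInE-split : ∀ {N} → HasCard (SemiBad q r) N → Card SquareInE (N + r)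
  squareInE-split semiBad = card-resp split (card-⊎ semiBad bad-card (λ (_ , _ , ¬bad , _) (_ , bad) → ¬bad bad))
    where
      split : ∀ a → (SemiBad q r a ⊎ (a < q × Bad q r a)) ⇔ SquareInE a
      split a = mk⇔ (λ { (inj₁ (a<q , _ , _ , sq)) → a<q , sq ; (inj₂ (a<q , bad)) → a<q , bad-square bad }) classify
        where
          classify : SquareInE a → SemiBad q r a ⊎ (a < q × Bad q r a)
          classify (a<q , sq) with bad? a
          ... | yes bad = inj₂ (a<q , bad)
          ... | no ¬bad = let (i , _ , 2ⁱ≈a²) = Equivalence.to (bad⇔ (a * a)) sq in
                          inj₁ (a<q , unit⇒coprime (square-unit {a} {i} (sym 2ⁱ≈a²)) , ¬bad , sq)

  -- SquareInE as a union of cosets of the square roots of 1.  Let b be a unit and e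
  -- an injective map from {j < m} onto the exponents i < r for which 2^i is a square,
  -- with b^j·b^j ≡ 2^(e j).  Then (j , u) ↦ u·b^j mod q is a bijection from
  -- {j < m} × {roots of 1} onto SquareInE.
  module Cosets (m b : ℕ) (b-unit : Unit b) (e : ℕ → ℕ)
                (bʲ-square : ∀ j → b ^ j * b ^ j ≈ 2 ^ e j)
                (e-bounded : ∀ j → j < m → e j < r)
                (e-injective : ∀ {j j′} → j < m → j′ < m → e j ≡ e j′ → j ≡ j′)
                (e-onto : ∀ a {i} → i < r → a * a ≈ 2 ^ i → ∃ λ j → j < m × e j ≡ i) where

    coset : ℕ × ℕ → ℕ
    coset (j , u) = (u * b ^ j) % q

    InCoset : ℕ × ℕ → Set
    InCoset (j , u) = j < m × Root q u

    coset-square : ∀ j u → u * u ≈ 1 → coset (j , u) * coset (j , u) ≈ 2 ^ e j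
    coset-square j u u²≈1 = begin
      (coset (j , u) * coset (j , u)) % q   ≡⟨ *-cong (%-≈ (u * b ^ j)) (%-≈ (u * b ^ j)) ⟩
      ((u * b ^ j) * (u * b ^ j)) % q       ≡⟨ ≈-reflexive (square-of-product u (b ^ j)) ⟩
      ((u * u) * (b ^ j * b ^ j)) % q       ≡⟨ *-cong u²≈1 (bʲ-square j) ⟩
      (1 * 2 ^ e j) % q                     ≡⟨ ≈-reflexive (*-identityˡ _) ⟩
      (2 ^ e j) % q                         ∎
      where open ≡-Reasoning

    -- Equal cosets have equal squares, hence equal j; then b^j cancels.
    coset-injective : ∀ {ju ju′} → InCoset ju → InCoset ju′ → coset ju ≡ coset ju′ → ju ≡ ju′
    coset-injective {j , u} {j′ , u′} (j<m , u<q , u²≡1) (j′<m , u′<q , u′²≡1) same = cong₂ _,_ j≡j′ u≡u′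
      where
        j≡j′ : j ≡ j′
        j≡j′ = e-injective j<m j′<m (pow-injective (e-bounded j j<m) (e-bounded j′ j′<m)
                 (trans (sym (coset-square j u (mod⇒≈ u²≡1)))
                   (trans (cong (λ x → (x * x) % q) same) (coset-square j′ u′ (mod⇒≈ u′²≡1)))))
        u≡u′ : u ≡ u′
        u≡u′ = ≈-reduced u<q u′<q (cancel {b ^ j} (unit-^ j b-unit)
                 (trans (≈-reflexive (*-comm (b ^ j) u))
                   (trans same (trans (cong (λ x → (u′ * b ^ x) % q) (sym j≡j′)) (≈-reflexive (*-comm u′ (b ^ j)))))))

    -- An element c of SquareInE has c² ≡ 2^i with i = e j for some j < m; then
    -- u = c·b^(-j) is a square root of 1 and c = u·b^j.
    coset-decompose : ∀ c → SquareInE c → ∃ λ ju → InCoset ju × c ≡ coset ju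
    coset-decompose c (c<q , sq) = (j , u) , (j<m , m%n<n _ q , ≈⇒mod u²≈1) , ≈-reduced c<q (m%n<n _ q) c≈ubʲ
      where
        i = proj₁ (Equivalence.to (bad⇔ (c * c)) sq)
        i<r = proj₁ (proj₂ (Equivalence.to (bad⇔ (c * c)) sq))
        c²≈2ⁱ : c * c ≈ 2 ^ i
        c²≈2ⁱ = sym (proj₂ (proj₂ (Equivalence.to (bad⇔ (c * c)) sq)))
        j = proj₁ (e-onto c i<r c²≈2ⁱ)
        j<m = proj₁ (proj₂ (e-onto c i<r c²≈2ⁱ))
        d = proj₁ (unit-^ j b-unit)
        bʲd≈1 : b ^ j * d ≈ 1
        bʲd≈1 = proj₂ (unit-^ j b-unit)
        u = (c * d) % q
        c²≈bʲbʲ : c * c ≈ b ^ j * b ^ j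
        c²≈bʲbʲ = trans c²≈2ⁱ (trans (cong (λ x → (2 ^ x) % q) (sym (proj₂ (proj₂ (e-onto c i<r c²≈2ⁱ)))))
                                     (sym (bʲ-square j)))
        u²≈1 : u * u ≈ 1
        u²≈1 = begin
          (u * u) % q                                ≡⟨ *-cong (%-≈ (c * d)) (%-≈ (c * d)) ⟩
          ((c * d) * (c * d)) % q                    ≡⟨ ≈-reflexive (square-of-product c d) ⟩
          ((c * c) * (d * d)) % q                    ≡⟨ *-cong c²≈bʲbʲ (refl {x = (d * d) % q}) ⟩
          ((b ^ j * b ^ j) * (d * d)) % q            ≡⟨ ≈-reflexive (sym (square-of-product (b ^ j) d)) ⟩
          ((b ^ j * d) * (b ^ j * d)) % q            ≡⟨ *-cong bʲd≈1 bʲd≈1 ⟩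
          1 % q                                      ∎
          where open ≡-Reasoning
        c≈ubʲ : c ≈ coset (j , u)
        c≈ubʲ = sym (begin
          coset (j , u) % q          ≡⟨ %-≈ (u * b ^ j) ⟩
          (u * b ^ j) % q            ≡⟨ *-cong (%-≈ (c * d)) (refl {x = (b ^ j) % q}) ⟩
          (c * d * b ^ j) % q        ≡⟨ ≈-reflexive (reassociate c d (b ^ j)) ⟩
          (c * (b ^ j * d)) % q      ≡⟨ *-cong (refl {x = c % q}) bʲd≈1 ⟩
          (c * 1) % q                ≡⟨ ≈-reflexive (*-identityʳ c) ⟩
          c % q                      ∎)
          where open ≡-Reasoning
                reassociate : ∀ c d x → c * d * x ≡ c * (x * d)
                reassociate = solve-∀

    squareInE-card : ∀ {S} → Card (Root q) S → Card SquareInE (m * S)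
    squareInE-card roots = card-image coset (card-× (card-< m) roots) coset-injective
      λ c → mk⇔ (coset-decompose c)
        λ { ((j , u) , (j<m , _ , u²≡1) , refl) →
              m%n<n _ q , Equivalence.from (bad⇔ _) (e j , e-bounded j j<m , sym (coset-square j u (mod⇒≈ u²≡1))) }

  -- If a² ≡ 2^(2t+1) then 2 is a square: (a·2^(-t))² ≡ 2.
  odd-power-square : ∀ a t → a * a ≈ 2 ^ suc (t + t) → TwoIsSquareMod q
  odd-power-square a t a²≈2²ᵗ⁺¹ = a * d , ≈⇒mod (begin
    ((a * d) * (a * d)) % q                  ≡⟨ ≈-reflexive (square-of-product a d) ⟩
    ((a * a) * (d * d)) % q                  ≡⟨ *-cong a²≈2²ᵗ⁺¹ (refl {x = (d * d) % q}) ⟩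
    (2 * 2 ^ (t + t) * (d * d)) % q          ≡⟨ ≈-reflexive (cong (λ x → 2 * x * (d * d)) (^-distribˡ-+-* 2 t t)) ⟩
    (2 * (2 ^ t * 2 ^ t) * (d * d)) % q      ≡⟨ ≈-reflexive (regroup (2 ^ t) d) ⟩
    (2 * ((2 ^ t * d) * (2 ^ t * d))) % q    ≡⟨ *-cong (refl {x = 2 % q}) (*-cong 2ᵗd≈1 2ᵗd≈1) ⟩
    2 % q                                    ∎)
    where
      open ≡-Reasoning
      d = proj₁ (pow-unit t)
      2ᵗd≈1 : 2 ^ t * d ≈ 1
      2ᵗd≈1 = proj₂ (pow-unit t)
      regroup : ∀ x d → 2 * (x * x) * (d * d) ≡ 2 * ((x * d) * (x * d))
      regroup = solve-∀

  two-square? : Dec (TwoIsSquareMod q)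
  two-square? = Decidable.map (mk⇔ (λ (x , _ , x²≈2) → x , ≈⇒mod x²≈2) reduce)
                              (anyUpTo? (λ x → (x * x) % q ≟ 2 % q) q)
    where
      reduce : TwoIsSquareMod q → ∃ λ x → x < q × x * x ≈ 2
      reduce (x , x²≡2) = x % q , m%n<n x q , trans (*-cong (%-≈ x) (%-≈ x)) (mod⇒≈ x²≡2)

  -- If 2 ≡ s², every power of 2 is a square: b = s, m = r, e = id.
  square-case : TwoIsSquareMod q → ∀ {S} → Card (Root q) S → Card SquareInE (r * S)
  square-case (s , s²≡2) = Cosets.squareInE-card r s (square-unit {s} {1} s²≈2) (λ j → j) sʲ-square
    (λ _ j<r → j<r) (λ _ _ j≡j′ → j≡j′) (λ _ {i} i<r _ → i , i<r , refl)
    where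
      s²≈2 : s * s ≈ 2
      s²≈2 = mod⇒≈ s²≡2
      sʲ-square : ∀ j → s ^ j * s ^ j ≈ 2 ^ j
      sʲ-square j = trans (≈-reflexive (square-^ s j)) (^-cong j s²≈2)

  -- If 2 is not a square then r is even, since otherwise 1·1 ≡ 2^r is an odd power.
  nonsquare⇒even : ¬ TwoIsSquareMod q → ∃ λ h → r ≡ h + h
  nonsquare⇒even ¬sq with parity r
  ... | t , inj₁ r≡2t   = t , r≡2t
  ... | t , inj₂ r≡2t+1 = ⊥-elim (¬sq (odd-power-square 1 t (subst (λ x → 1 ≈ 2 ^ x) r≡2t+1 (sym 2ʳ≈1))))

  -- If 2 is not a square, exactly the even powers of 2 are squares: b = 2, m = r/2, e j = 2j.
  nonsquare-case : ¬ TwoIsSquareMod q → ∀ {h} → r ≡ h + h → ∀ {S} → Card (Root q) S → Card SquareInE (h * S)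
  nonsquare-case ¬sq {h} r≡2h = Cosets.squareInE-card h 2 (pow-unit 1) (λ j → j + j)
    (λ j → ≈-reflexive (sym (^-distribˡ-+-* 2 j j))) bounded (λ _ _ → double-injective _ _) even
    where
      bounded : ∀ j → j < h → j + j < r
      bounded j j<h = subst (j + j <_) (sym r≡2h) (+-mono-< j<h j<h)
      even : ∀ a {i} → i < r → a * a ≈ 2 ^ i → ∃ λ j → j < h × j + j ≡ i
      even a {i} i<r a²≈2ⁱ with parity i
      ... | t , inj₁ i≡2t   = t , double-<-reflect t h (subst₂ _<_ i≡2t r≡2h i<r) , sym i≡2t
      ... | t , inj₂ i≡2t+1 = ⊥-elim (¬sq (odd-power-square a t (subst (λ x → a * a ≈ 2 ^ x) i≡2t+1 a²≈2ⁱ)))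

  -- Counting SquareInE in two ways: N + r semi-bad-or-bad classes, against
  -- (number of square powers of 2) × 2^ω(q) square roots of 1.
  semiBad-count : ∀ {w N} → ¬ 2 ∣ q → IsOmega q w → HasCard (SemiBad q r) N →
                  (TwoIsSquareMod q × N + r ≡ r * 2 ^ w) ⊎
                  (¬ TwoIsSquareMod q × ∃ λ h → r ≡ h + h × N + r ≡ h * 2 ^ w)
  semiBad-count odd (ps , ps! , refl , primes) semiBad with two-square?
  ... | yes sq = inj₁ (sq , card-unique (squareInE-split semiBad) (square-case sq (roots-count ps q odd ps! primes)))
  ... | no ¬sq = let (h , r≡2h) = nonsquare⇒even ¬sq in
    inj₂ (¬sq , h , r≡2h , card-unique (squareInE-split semiBad) (nonsquare-case ¬sq {h} r≡2h (roots-count ps q odd ps! primes)))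

half-double : ∀ t → (t + t) / 2 ≡ t
half-double t = trans (cong (_/ 2) (twice t)) (m*n/n≡m t 2)
  where twice : ∀ t → t + t ≡ t * 2
        twice = solve-∀

half-suc-double : ∀ t → suc (t + t) / 2 ≡ t
half-suc-double t = trans (cong (_/ 2) (twice+1 t)) (trans (+-distrib-/ 1 (t * 2) remainders<2) (m*n/n≡m t 2))
  where twice+1 : ∀ t → suc (t + t) ≡ 1 + t * 2
        twice+1 = solve-∀
        remainders<2 : 1 % 2 + (t * 2) % 2 < 2
        remainders<2 = subst (λ x → 1 + x < 2) (sym (m*n%n≡0 t 2)) (s≤s (s≤s z≤n))

halves : ∀ r → (r + 1) / 2 + r / 2 ≡ r
halves r with parity r
... | t , inj₁ refl = cong₂ _+_ (trans (cong (_/ 2) (+-comm (t + t) 1)) (half-suc-double t)) (half-double t)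
... | t , inj₂ refl = begin
  (suc (t + t) + 1) / 2 + suc (t + t) / 2  ≡⟨ cong₂ (λ x y → x / 2 + y) (twice-suc t) (half-suc-double t) ⟩
  (suc t + suc t) / 2 + t                  ≡⟨ cong (_+ t) (half-double (suc t)) ⟩
  suc t + t                                ∎
  where open ≡-Reasoning
        twice-suc : ∀ t → suc (t + t) + 1 ≡ suc t + suc t
        twice-suc = solve-∀

cancel-r : ∀ N r x → N + r ≡ r * x → N ≡ r * (x ∸ 1)
cancel-r N r x N+r≡rx = sym (begin
  r * (x ∸ 1)    ≡⟨ *-distribˡ-∸ r x 1 ⟩
  r * x ∸ r * 1  ≡⟨ cong₂ _∸_ (sym N+r≡rx) (*-identityʳ r) ⟩
  N + r ∸ r      ≡⟨ m+n∸n≡m N r ⟩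
  N              ∎)
  where open ≡-Reasoning

SemiBadFormula : ℕ → ℕ → ℕ → ℕ → Set
SemiBadFormula r w q₂ N =
  (N + r ≡ 2 ^ w * ((r + 1) / 2 + q₂ * (r / 2)))
  × ((2 ∣ r × q₂ ≡ 0) → N ≡ r * (2 ^ (w ∸ 1) ∸ 1))
  × (¬ (2 ∣ r × q₂ ≡ 0) → N ≡ r * (2 ^ w ∸ 1))

formula-square : ∀ {r} w {N} → N + r ≡ r * 2 ^ w → SemiBadFormula r w 1 N
formula-square {r} w {N} N+r≡r2ʷ =
  trans N+r≡r2ʷ (trans (*-comm r (2 ^ w)) (cong (2 ^ w *_) (sym ⌈r/2⌉+⌊r/2⌋≡r))) ,
  (λ { (_ , ()) }) ,
  λ _ → cancel-r N r (2 ^ w) N+r≡r2ʷ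
  where
    ⌈r/2⌉+⌊r/2⌋≡r : (r + 1) / 2 + 1 * (r / 2) ≡ r
    ⌈r/2⌉+⌊r/2⌋≡r = trans (cong ((r + 1) / 2 +_) (*-identityˡ (r / 2))) (halves r)

formula-nonsquare : ∀ {r} w {N} h → r ≡ h + h → 1 ≤ w → N + r ≡ h * 2 ^ w → SemiBadFormula r w 0 N
formula-nonsquare (suc w′) {N} h refl (s≤s z≤n) N+r≡h2ʷ =
  trans N+r≡h2ʷ (trans (*-comm h (2 ^ suc w′)) (cong (2 ^ suc w′ *_) (sym ⌈r/2⌉≡h))) ,
  (λ _ → cancel-r N (h + h) (2 ^ w′) (trans N+r≡h2ʷ (regroup h (2 ^ w′)))) ,
  λ ¬[2∣r×q₂≡0] → contradiction (divides h (twice h) , refl) ¬[2∣r×q₂≡0]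
  where
    ⌈r/2⌉≡h : (h + h + 1) / 2 + 0 ≡ h
    ⌈r/2⌉≡h = trans (+-identityʳ _) (trans (cong (_/ 2) (+-comm (h + h) 1)) (half-suc-double h))
    regroup : ∀ h x → h * (2 * x) ≡ (h + h) * x
    regroup = solve-∀
    twice : ∀ h → h + h ≡ h * 2
    twice = solve-∀

omega-positive : ∀ {q w} → 2 ≤ q → IsOmega q w → 1 ≤ w
omega-positive {q} q≥2 (ps , _ , refl , primes) =
  let (p , pp , p∣q) = prime-factor q q≥2 in ∈-length (Equivalence.from (primes p) (pp , p∣q))

lemma1 : (q r w q₂ N : ℕ) → 3 ≤ q → ¬ (2 ∣ q) → IsOrderOf2 q r → IsOmega q w
    → (TwoIsSquareMod q → q₂ ≡ 1) → (¬ TwoIsSquareMod q → q₂ ≡ 0)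
    → HasCard (SemiBad q r) N
    → (N + r ≡ 2 ^ w * ((r + 1) / 2 + q₂ * (r / 2)))
      × ((2 ∣ r × q₂ ≡ 0) → N ≡ r * (2 ^ (w ∸ 1) ∸ 1))
      × (¬ (2 ∣ r × q₂ ≡ 0) → N ≡ r * (2 ^ w ∸ 1))
lemma1 q r w q₂ N q≥3 odd order ω square⇒q₂≡1 nonsquare⇒q₂≡0 semiBad
  with PowersOfTwo.semiBad-count q r {{>-nonZero (<-trans (s≤s z≤n) q≥3)}} order odd ω semiBad
... | inj₁ (sq , count) =
  subst (λ x → SemiBadFormula r w x N) (sym (square⇒q₂≡1 sq)) (formula-square w count)
... | inj₂ (¬sq , h , r≡2h , count) =
  subst (λ x → SemiBadFormula r w x N) (sym (nonsquare⇒q₂≡0 ¬sq))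
        (formula-nonsquare w h r≡2h (omega-positive (<⇒≤ q≥3) ω) count)
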